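{- Let $F$ be a class of first order formulas and let $G$ be a digraph definable by some sentence in $F$. Let $A$ be a sentence in $F$. Then $A$ defines $G$ if and only if $A$ is an $F$-description of $G$.
   Context: A digraph is a finite non-empty vertex set with a binary arc relation. First order formulas about digraphs use variables over vertices, relations $=$ and $\mapsto$, quantifiers and Boolean connectives. A sentence defines $G$ if it is true on $G$ and false on every digraph not isomorphic to $G$. For a tuple $\bar u\in V(G)^s$, $G,\bar u\models A(\bar x)$ means $A(x_1,\dots,x_s)$ is true in $G$ when each $x_i$ is assigned $u_i$; $\models A(\bar x)$ means $A(\bar x)$ is true on every digraph with every $s$-tuple of vertices; $X\Rightarrow Y$ abbreviates $(\neg X)\vee Y$. A formula $A(\bar x)\in F$ is an $F$-description of $(G,\bar u)$ if $G,\bar u\models A(\bar x)$ and, for every $B(\bar x)\in F$ with $G,\bar u\models B(\bar x)$, we have $\models A(\bar x)\Rightarrow B(\bar x)$. For sentences ($s=0$) this is an $F$-description of $G$. -}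

module Defs where

open import Data.Nat using (ℕ; zero; suc)
open import Data.Fin using (Fin; zero; suc)
open import Data.Bool using (Bool; true; false; _∧_; _∨_; not; if_then_else_)
open import Data.Fin using (_≟_)
open import Relation.Nullary using (¬_; does)
open import Relation.Binary.PropositionalEquality using (_≡_)
open import Data.Product using (Σ; _×_)
open import Function.Bundles using (_↔_; Inverse)

record Digraph : Set where
  field
    size : ℕ
    arc  : Fin (suc size) → Fin (suc size) → Bool
open Digraph public

V : Digraph → Set
V G = Fin (suc (size G))

-- First order formulas with free variables among x_1..x_n (de Bruijn, Fin n).
data Formula : ℕ → Set where
  _≐_  : ∀ {n} → Fin n → Fin n → Formula n
  _↦_  : ∀ {n} → Fin n → Fin n → Formula n
  ¬'_  : ∀ {n} → Formula n → Formula n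
  _∧'_ : ∀ {n} → Formula n → Formula n → Formula n
  _∨'_ : ∀ {n} → Formula n → Formula n → Formula n
  _⇒'_ : ∀ {n} → Formula n → Formula n → Formula n
  ∀'   : ∀ {n} → Formula (suc n) → Formula n    -- binds the new variable zero
  ∃'   : ∀ {n} → Formula (suc n) → Formula n

Sentence : Set
Sentence = Formula 0

allFin : ∀ k → (Fin k → Bool) → Bool
allFin zero    f = true
allFin (suc k) f = f zero ∧ allFin k (λ i → f (suc i))

anyFin : ∀ k → (Fin k → Bool) → Bool
anyFin zero    f = false
anyFin (suc k) f = f zero ∨ anyFin k (λ i → f (suc i))

extend : ∀ {n} {A : Set} → A → (Fin n → A) → Fin (suc n) → A
extend a ρ zero    = a
extend a ρ (suc i) = ρ i

⟦_⟧ : ∀ {n} → Formula n → (G : Digraph) → (Fin n → V G) → Bool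
⟦ x ≐ y ⟧ G ρ = does (ρ x ≟ ρ y)
⟦ x ↦ y ⟧ G ρ = arc G (ρ x) (ρ y)
⟦ ¬' A ⟧ G ρ = not (⟦ A ⟧ G ρ)
⟦ A ∧' B ⟧ G ρ = ⟦ A ⟧ G ρ ∧ ⟦ B ⟧ G ρ
⟦ A ∨' B ⟧ G ρ = ⟦ A ⟧ G ρ ∨ ⟦ B ⟧ G ρ
⟦ A ⇒' B ⟧ G ρ = not (⟦ A ⟧ G ρ) ∨ ⟦ B ⟧ G ρ
⟦ ∀' A ⟧ G ρ = allFin (suc (size G)) (λ v → ⟦ A ⟧ G (extend v ρ))
⟦ ∃' A ⟧ G ρ = anyFin (suc (size G)) (λ v → ⟦ A ⟧ G (extend v ρ))

_,_⊨_ : ∀ {n} (G : Digraph) → (Fin n → V G) → Formula n → Set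
G , ρ ⊨ A = ⟦ A ⟧ G ρ ≡ true

[] : ∀ {G : Digraph} → Fin 0 → V G
[] ()

Valid : ∀ {n} → Formula n → Set
Valid {n} A = ∀ (H : Digraph) (ρ : Fin n → V H) → H , ρ ⊨ A

_≅_ : Digraph → Digraph → Set
G ≅ H = Σ (V G ↔ V H) λ f →
  ∀ u v → arc G u v ≡ arc H (Inverse.to f u) (Inverse.to f v)

Defines : Sentence → Digraph → Set
Defines A G = (G , [] {G} ⊨ A) × (∀ (H : Digraph) → ¬ (H ≅ G) → ⟦ A ⟧ H ([] {H}) ≡ false)

Class : Set₁
Class = ∀ {n} → Formula n → Set

-- A is an F-description of (G, ū).  (Membership A ∈ F is assumed separately.)
IsDescription : (F : Class) → ∀ {n} (G : Digraph) → (Fin n → V G) → Formula n → Set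
IsDescription F {n} G ρ A =
  (G , ρ ⊨ A) × (∀ (B : Formula n) → F B → G , ρ ⊨ B → Valid (A ⇒' B))

DefinableIn : Class → Digraph → Set
DefinableIn F G = Σ Sentence λ C → F C × Defines C G

-- A sentence has the same truth value on isomorphic digraphs. So if A defines G and B
-- holds on G, then B holds on every model of A, since such a model cannot fail to be
-- isomorphic to G: A ⇒ B is valid. Conversely, if A is an F-description and C ∈ F defines
-- G, then A ⇒ C is valid, so A fails wherever C does, i.e. off the isomorphism class of G.
module Submission where

open import Defs
open import Data.Bool using (Bool; true; false; _∧_; _∨_; not)
open import Data.Bool.Properties using (not-¬; ¬-not) renaming (_≟_ to _≟ᵇ_)
open import Data.Fin using (Fin; zero; suc; _≟_)
open import Data.Nat using (ℕ; zero; suc)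
open import Data.Product using (∃; _,_; proj₁; proj₂)
open import Function.Bundles using (_↔_; _⇔_; mk⇔; Inverse; Injection; Equivalence)
open import Function.Properties.Inverse using (↔-refl; ↔⇒↣)
open import Relation.Nullary using (¬_; does)
open import Relation.Nullary.Decidable using (does-⇔; decidable-stable)
open import Relation.Binary.PropositionalEquality
  using (_≡_; refl; sym; trans; cong; cong₂; module ≡-Reasoning)

bool-ext : ∀ {x y : Bool} → (x ≡ true ⇔ y ≡ true) → x ≡ y
bool-ext {false} {false} _   = refl
bool-ext {false} {true}  x⇔y = Equivalence.from x⇔y refl
bool-ext {true}  {false} x⇔y = sym (Equivalence.to x⇔y refl)
bool-ext {true}  {true}  _   = refl

allFin⁻ : ∀ k {p : Fin k → Bool} → allFin k p ≡ true → ∀ i → p i ≡ true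
allFin⁻ (suc k) {p} all-p i with p zero in p₀
allFin⁻ (suc k) {p} all-p zero    | true = p₀
allFin⁻ (suc k) {p} all-p (suc i) | true = allFin⁻ k all-p i

allFin⁺ : ∀ k {p : Fin k → Bool} → (∀ i → p i ≡ true) → allFin k p ≡ true
allFin⁺ zero    all-p = refl
allFin⁺ (suc k) all-p rewrite all-p zero = allFin⁺ k (λ i → all-p (suc i))

anyFin⁻ : ∀ k {p : Fin k → Bool} → anyFin k p ≡ true → ∃ λ i → p i ≡ true
anyFin⁻ (suc k) {p} any-p with p zero in p₀
... | true  = zero , p₀
... | false = let i , pᵢ = anyFin⁻ k any-p in suc i , pᵢ

anyFin⁺ : ∀ k {p : Fin k → Bool} i → p i ≡ true → anyFin k p ≡ true
anyFin⁺ (suc k)     zero    pᵢ rewrite pᵢ = refl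
anyFin⁺ (suc k) {p} (suc i) pᵢ with p zero
... | true  = refl
... | false = anyFin⁺ k i pᵢ

module _ {k l : ℕ} (f : Fin k ↔ Fin l) {p : Fin k → Bool} {q : Fin l → Bool}
         (p≗q∘to : ∀ i → p i ≡ q (Inverse.to f i)) where
  open Inverse f using (to; from; strictlyInverseˡ)

  q∘to∘from : ∀ j → q (to (from j)) ≡ q j
  q∘to∘from j = cong q (strictlyInverseˡ j)

  allFin-↔ : allFin k p ≡ allFin l q
  allFin-↔ = bool-ext (mk⇔
    (λ all-p → allFin⁺ l λ j →
      trans (sym (trans (p≗q∘to (from j)) (q∘to∘from j))) (allFin⁻ k all-p (from j)))
    (λ all-q → allFin⁺ k λ i → trans (p≗q∘to i) (allFin⁻ l all-q (to i))))

  anyFin-↔ : anyFin k p ≡ anyFin l q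
  anyFin-↔ = bool-ext (mk⇔
    (λ any-p → let i , pᵢ = anyFin⁻ k any-p in
      anyFin⁺ l (to i) (trans (sym (p≗q∘to i)) pᵢ))
    (λ any-q → let j , qⱼ = anyFin⁻ l any-q in
      anyFin⁺ k (from j) (trans (trans (p≗q∘to (from j)) (q∘to∘from j)) qⱼ)))

extend-map : ∀ {n} {A B : Set} (h : A → B) {a : A} {ρ : Fin n → A} {σ : Fin n → B} →
             (∀ i → h (ρ i) ≡ σ i) → ∀ i → h (extend a ρ i) ≡ extend (h a) σ i
extend-map h h∘ρ≗σ zero    = refl
extend-map h h∘ρ≗σ (suc i) = h∘ρ≗σ i

module _ {H G : Digraph} (iso : H ≅ G) where
  open Inverse (proj₁ iso) using (to)

  to-≡⇔ : ∀ {a b : V H} → a ≡ b ⇔ to a ≡ to b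
  to-≡⇔ = mk⇔ (cong to) (Injection.injective (↔⇒↣ (proj₁ iso)))

  ⟦⟧-≅ : ∀ {n} (A : Formula n) {ρ : Fin n → V H} {σ : Fin n → V G} →
         (∀ i → to (ρ i) ≡ σ i) → ⟦ A ⟧ H ρ ≡ ⟦ A ⟧ G σ
  ⟦⟧-≅ (x ≐ y) {ρ} {σ} e = begin
    does (ρ x ≟ ρ y)           ≡⟨ does-⇔ to-≡⇔ (ρ x ≟ ρ y) (to (ρ x) ≟ to (ρ y)) ⟩
    does (to (ρ x) ≟ to (ρ y)) ≡⟨ cong₂ (λ a b → does (a ≟ b)) (e x) (e y) ⟩
    does (σ x ≟ σ y)           ∎
    where open ≡-Reasoning
  ⟦⟧-≅ (x ↦ y) {ρ} e = trans (proj₂ iso (ρ x) (ρ y)) (cong₂ (arc G) (e x) (e y))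
  ⟦⟧-≅ (¬' A) e = cong not (⟦⟧-≅ A e)
  ⟦⟧-≅ (A ∧' B) e = cong₂ _∧_ (⟦⟧-≅ A e) (⟦⟧-≅ B e)
  ⟦⟧-≅ (A ∨' B) e = cong₂ _∨_ (⟦⟧-≅ A e) (⟦⟧-≅ B e)
  ⟦⟧-≅ (A ⇒' B) e = cong₂ (λ a b → not a ∨ b) (⟦⟧-≅ A e) (⟦⟧-≅ B e)
  ⟦⟧-≅ (∀' A) {σ = σ} e =
    allFin-↔ (proj₁ iso) {q = λ w → ⟦ A ⟧ G (extend w σ)} (λ v → ⟦⟧-≅ A (extend-map to e))
  ⟦⟧-≅ (∃' A) {σ = σ} e =
    anyFin-↔ (proj₁ iso) {q = λ w → ⟦ A ⟧ G (extend w σ)} (λ v → ⟦⟧-≅ A (extend-map to e))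

≅-refl : ∀ {G} → G ≅ G
≅-refl = ↔-refl , λ u v → refl

⟦⟧-cong : ∀ {n} {G} (A : Formula n) {ρ σ : Fin n → V G} →
          (∀ i → ρ i ≡ σ i) → ⟦ A ⟧ G ρ ≡ ⟦ A ⟧ G σ
⟦⟧-cong = ⟦⟧-≅ ≅-refl

⊨-⇒'⁺ : ∀ {n} {G} {ρ : Fin n → V G} (A B : Formula n) →
        (G , ρ ⊨ A → G , ρ ⊨ B) → G , ρ ⊨ (A ⇒' B)
⊨-⇒'⁺ {G = G} {ρ} A B A→B with ⟦ A ⟧ G ρ
... | false = refl
... | true  = A→B refl

⊨-⇒'⁻ : ∀ {n} {G} {ρ : Fin n → V G} (A B : Formula n) →
        G , ρ ⊨ (A ⇒' B) → G , ρ ⊨ A → G , ρ ⊨ B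
⊨-⇒'⁻ A B A⇒B ⊨A rewrite ⊨A = A⇒B

Valid-sentence : (A : Sentence) → (∀ H → H , [] {H} ⊨ A) → Valid A
Valid-sentence A ⊨A H ρ = trans (⟦⟧-cong A (λ ())) (⊨A H)

⊨-≅ : ∀ {H G} → H ≅ G → (B : Sentence) → G , [] {G} ⊨ B → H , [] {H} ⊨ B
⊨-≅ iso B G⊨B = trans (⟦⟧-≅ iso B (λ ())) G⊨B

Defines⇒¬¬≅ : ∀ A {G H} → Defines A G → H , [] {H} ⊨ A → ¬ ¬ (H ≅ G)
Defines⇒¬¬≅ A (_ , false-off-G) H⊨A H≇G = not-¬ H⊨A (false-off-G _ H≇G)

-- H ≅ G is only available doubly negated, but H ⊨ B is a Boolean equation, hence stable.
Defines⇒entails : ∀ A {G} → Defines A G → (B : Sentence) → G , [] {G} ⊨ B →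
                  ∀ H → H , [] {H} ⊨ A → H , [] {H} ⊨ B
Defines⇒entails A A-defines B G⊨B H H⊨A =
  decidable-stable (⟦ B ⟧ H [] ≟ᵇ true)
    (λ H⊭B → Defines⇒¬¬≅ A A-defines H⊨A (λ iso → H⊭B (⊨-≅ iso B G⊨B)))

Defines⇒IsDescription : (F : Class) (G : Digraph) (A : Sentence) →
                        Defines A G → IsDescription F G ([] {G}) A
Defines⇒IsDescription F G A A-defines = proj₁ A-defines , λ B _ G⊨B →
  Valid-sentence (A ⇒' B) λ H → ⊨-⇒'⁺ A B (Defines⇒entails A A-defines B G⊨B H)

IsDescription⇒Defines : (F : Class) (G : Digraph) → DefinableIn F G → (A : Sentence) →
                        IsDescription F G ([] {G}) A → Defines A G
IsDescription⇒Defines F G (C , F∋C , C-defines) A (G⊨A , A-describes) =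
  G⊨A , λ H H≇G → ¬-not λ H⊨A →
    not-¬ (⊨-⇒'⁻ A C (A-describes C F∋C (proj₁ C-defines) H []) H⊨A)
          (proj₂ C-defines H H≇G)

lemma9 : (F : Class) (G : Digraph) → DefinableIn F G →
    (A : Sentence) → F A → (Defines A G ⇔ IsDescription F G ([] {G}) A)
lemma9 F G G-definable A _ =
  mk⇔ (Defines⇒IsDescription F G A) (IsDescription⇒Defines F G G-definable A)
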